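{- Let $l,t,s,x,n$ be integers with $2\le l\le t$, $s\ge l+1$, $s\ge x\ge l$ and $n\ge x+(t-1)\binom{x}{l}+2(s-x)+1$. (a) If $2(s-x)+1\le t$, then the graph $G_1^x$ defined below is $\{K_{l,t},M_{s+1}\}$-free. (b) If $2(s-x)+1\ge t+1$, then the graph $G_2^x$ defined below is $\{K_{l,t},M_{s+1}\}$-free. Construction of $G_1^x$: take a $K_{1,l}$-free graph $X$ on $x$ vertices with $ex(x,K_{1,l})$ edges and a $K_{l,t}$-free graph $S$ on $2(s-x)+1$ vertices with $ex(2(s-x)+1,K_{l,t})$ edges, on disjoint vertex sets. For each $l$-element subset $F\subseteq V(X)$, add a set $V_F$ of $t-1$ new vertices and join every vertex of $F$ to every vertex of $V_F$. Fix a subset $F_0\subseteq V(X)$ with $|F_0|=l-1$ and join every vertex of $S$ to every vertex of $F_0$. Finally add a set $U$ of $n-x-(t-1)\binom{x}{l}-2(s-x)-1$ new vertices and join every vertex of $U$ to every vertex of $F_0$. The result is an $n$-vertex graph $G_1^x$. Construction of $G_2^x$: the same as $G_1^x$ except that there are no edges between $V(S)$ and $V(X)$ (i.e. the edges joining $S$ to $F_0$ are omitted).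
   Context: All graphs are finite, simple and undirected. A graph is $\mathscr{F}$-free if it contains no member of the family $\mathscr{F}$ as a subgraph; $ex(m,F)$ is the maximum number of edges of an $F$-free graph on $m$ vertices. $K_{l,t}$ is the complete bipartite graph with parts of sizes $l$ and $t$, $K_{1,l}$ is the star with $l$ leaves, and $M_{s+1}$ is a matching of $s+1$ pairwise disjoint edges. -}

module Defs where

open import Data.Nat using (ℕ; zero; suc; _+_; _*_; _∸_; _≤_; _<ᵇ_)
open import Data.Nat.Combinatorics using (_C_)
open import Data.Bool using (Bool; true; false; T; _∧_; if_then_else_)
open import Data.Fin using (Fin; toℕ)
open import Data.Fin.Subset using (Subset; _∈_; ∣_∣)
open import Data.List using (List; map; allFin)
open import Data.Nat.ListAction using (sum)
open import Data.Product using (Σ; _×_; _,_)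
open import Data.Sum using (_⊎_; inj₁; inj₂)
open import Data.Unit using (⊤)
open import Data.Empty using (⊥)
open import Relation.Nullary using (¬_)
open import Relation.Binary.PropositionalEquality using (_≡_; _≢_)
open import Function.Definitions using (Injective)

record Graph (n : ℕ) : Set where
  field
    adj    : Fin n → Fin n → Bool
    sym    : ∀ i j → adj i j ≡ adj j i
    irrefl : ∀ i → adj i i ≡ false
open Graph public

GAdj : ∀ {n} → Graph n → Fin n → Fin n → Set
GAdj G i j = T (adj G i j)

edges : ∀ {n} → Graph n → ℕ
edges {n} G =
  sum (map (λ i → sum (map (λ j → if (toℕ i <ᵇ toℕ j) ∧ adj G i j then 1 else 0)
                            (allFin n)))
           (allFin n))

Contains : {P : Set} → (P → P → Set) → {V : Set} → (V → V → Set) → Set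
Contains {P} R {V} Adj =
  Σ (P → V) λ f → Injective _≡_ _≡_ f × (∀ p q → R p q → Adj (f p) (f q))

Free : {P : Set} → (P → P → Set) → {V : Set} → (V → V → Set) → Set
Free R Adj = ¬ Contains R Adj

KBip : (a b : ℕ) → Fin a ⊎ Fin b → Fin a ⊎ Fin b → Set
KBip a b (inj₁ _) (inj₂ _) = ⊤
KBip a b (inj₂ _) (inj₁ _) = ⊤
KBip a b _        _        = ⊥

Star : (l : ℕ) → Fin 1 ⊎ Fin l → Fin 1 ⊎ Fin l → Set
Star l = KBip 1 l

Matching : (k : ℕ) → Fin k × Bool → Fin k × Bool → Set
Matching k (i , a) (j , b) = (i ≡ j) × (a ≢ b)

Extremal : ∀ {m} {P : Set} → (P → P → Set) → Graph m → Set
Extremal {m} R G = Free R (GAdj G) × (∀ (H : Graph m) → Free R (GAdj H) → edges H ≤ edges G)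

LSub : (x l : ℕ) → Set
LSub x l = Σ (Subset x) λ F → ∣ F ∣ ≡ l

sSize : (s x : ℕ) → ℕ
sSize s x = 2 * (s ∸ x) + 1

uSize : (l t s x n : ℕ) → ℕ
uSize l t s x n = n ∸ (x + (t ∸ 1) * (x C l) + 2 * (s ∸ x) + 1)

-- Vertex set: V(X) ⊎ (⋃_F V_F) ⊎ V(S) ⊎ U
Vtx : (l t s x n : ℕ) → Set
Vtx l t s x n = Fin x ⊎ (LSub x l × Fin (t ∸ 1)) ⊎ Fin (sSize s x) ⊎ Fin (uSize l t s x n)

GAdjC : (joinS : Bool) (l t s x n : ℕ) → Graph x → Graph (sSize s x) → Subset x →
        Vtx l t s x n → Vtx l t s x n → Set
GAdjC j l t s x n X S F0 (inj₁ a) (inj₁ b) = GAdj X a b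
GAdjC j l t s x n X S F0 (inj₁ a) (inj₂ (inj₁ ((F , _) , _))) = a ∈ F
GAdjC j l t s x n X S F0 (inj₂ (inj₁ ((F , _) , _))) (inj₁ a) = a ∈ F
GAdjC j l t s x n X S F0 (inj₁ a) (inj₂ (inj₂ (inj₁ _))) = T j × a ∈ F0
GAdjC j l t s x n X S F0 (inj₂ (inj₂ (inj₁ _))) (inj₁ a) = T j × a ∈ F0
GAdjC j l t s x n X S F0 (inj₁ a) (inj₂ (inj₂ (inj₂ _))) = a ∈ F0
GAdjC j l t s x n X S F0 (inj₂ (inj₂ (inj₂ _))) (inj₁ a) = a ∈ F0
GAdjC j l t s x n X S F0 (inj₂ (inj₂ (inj₁ c))) (inj₂ (inj₂ (inj₁ d))) = GAdj S c d
GAdjC j l t s x n X S F0 _ _ = ⊥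

G1 G2 : (l t s x n : ℕ) → Graph x → Graph (sSize s x) → Subset x →
        Vtx l t s x n → Vtx l t s x n → Set
G1 = GAdjC true
G2 = GAdjC false

KMFree : (l t s : ℕ) → {V : Set} → (V → V → Set) → Set
KMFree l t s Adj = Free (KBip l t) Adj × Free (Matching (suc s)) Adj

module Submission where

-- Every edge of G₁ˣ and G₂ˣ meets X or lies inside S, so a matching has at most
-- x + (s - x) = s edges.  A vertex adjacent to l vertices of X lies in some V_F: X is
-- K_{1,l}-free, and S and U see only the l - 1 vertices of F₀.  All common neighbours of
-- one l-set of X lie in the same V_F, which has only t - 1 vertices, so neither side of a
-- copy of K_{l,t} lies inside X.  Hence the copy has an edge avoiding X; that edge lies in
-- S, so the whole copy lies in S ∪ F₀.  In G₁ˣ this set has fewer than l + t vertices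
-- (|S| ≤ t); in G₂ˣ the copy lies inside the K_{l,t}-free graph S.

open import Defs hiding (sym)
open import Data.Nat using (ℕ; zero; suc; _+_; _*_; _∸_; _≤_; _<_; z≤n; s≤s)
open import Data.Nat.Properties
  using (≤-refl; ≤-reflexive; ≤-trans; <-irrefl; <⇒≱; n<1+n; +-comm; +-monoˡ-≤; +-monoʳ-<;
         +-cancelˡ-≤; m+[n∸m]≡n; ≡-irrelevant; module ≤-Reasoning)
open import Data.Nat.Combinatorics using (_C_)
open import Data.Nat.Tactic.RingSolver using (solve-∀)
open import Data.Bool using (Bool; true; false; T; if_then_else_)
open import Data.Fin using (Fin; zero; suc; join; splitAt; inject≤; fromℕ<; _↑ˡ_; _↑ʳ_)
open import Data.Fin.Properties
  using (injective⇒≤; suc-injective; 0≢1+n; inject≤-injective; all?; ¬∀⟶∃¬;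
         +↔⊎; *↔×; 2↔Bool)
open import Data.Fin.Subset using (Subset; ∣_∣; _∈_; _⊆_; _-_; ⊤)
open import Data.Fin.Subset.Properties
  using (_∈?_; x∈p∧x≢y⇒x∈p-y; x∈p⇒∣p-x∣<∣p∣; ⊆-antisym)
open import Data.Vec using (_++_; here; there)
open import Data.Vec.Functional using (_∷_)
open import Data.Sum using (_⊎_; inj₁; inj₂)
open import Data.Sum.Properties using (inj₁-injective; inj₂-injective)
open import Data.Sum.Function.Propositional using (_⊎-↔_)
open import Data.Product using (Σ; _×_; _,_; proj₁; proj₂)
open import Data.Product.Function.NonDependent.Propositional using (_×-↔_)
open import Data.Unit using (tt)
open import Data.Empty using (⊥-elim)
open import Relation.Nullary using (¬_; yes; no; Dec)
open import Relation.Binary.PropositionalEquality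
open import Function using (_∘_)
open import Function.Definitions using (Injective)
open import Function.Bundles using (Injection; _↣_; _↔_; mk↣)
open import Function.Properties.Inverse using (↔⇒↣)
open import Function.Construct.Symmetry using (↔-sym)
open import Function.Construct.Identity using (↔-id)
open import Function.Construct.Composition using (_↣-∘_; _↔-∘_)

↣⇒≤ : ∀ {m n} → Fin m ↣ Fin n → m ≤ n
↣⇒≤ f = injective⇒≤ (Injection.injective f)

injection-into⇒≤∣p∣ : ∀ {m n} {p : Subset n} (g : Fin m → Fin n) → Injective _≡_ _≡_ g →
                      (∀ i → g i ∈ p) → m ≤ ∣ p ∣
injection-into⇒≤∣p∣ {zero}  g g-inj g∈p = z≤n
injection-into⇒≤∣p∣ {suc m} {p = p} g g-inj g∈p =
  ≤-trans (s≤s (injection-into⇒≤∣p∣ (g ∘ suc) (suc-injective ∘ g-inj) g∈p-g₀))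
          (x∈p⇒∣p-x∣<∣p∣ (g∈p zero))
  where
  g∈p-g₀ : ∀ i → g (suc i) ∈ p - g zero
  g∈p-g₀ i = x∈p∧x≢y⇒x∈p-y (g∈p (suc i)) (λ eq → 0≢1+n (sym (g-inj eq)))

injection-onto⇒⊆ : ∀ {m n} {p q : Subset n} (g : Fin m → Fin n) → Injective _≡_ _≡_ g →
                   ∣ p ∣ ≤ m → (∀ i → g i ∈ p) → (∀ i → g i ∈ q) → p ⊆ q
injection-onto⇒⊆ {p = p} {q} g g-inj ∣p∣≤m g∈p g∈q {y} y∈p with y ∈? q
... | yes y∈q = y∈q
... | no  y∉q =
  ⊥-elim (<-irrefl refl (≤-trans (injection-into⇒≤∣p∣ (y ∷ g) y∷g-inj y∷g∈p) ∣p∣≤m))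
  where
  y∷g-inj : Injective _≡_ _≡_ (y ∷ g)
  y∷g-inj {zero}  {zero}  eq = refl
  y∷g-inj {zero}  {suc j} eq = ⊥-elim (y∉q (subst (_∈ q) (sym eq) (g∈q j)))
  y∷g-inj {suc i} {zero}  eq = ⊥-elim (y∉q (subst (_∈ q) eq (g∈q i)))
  y∷g-inj {suc i} {suc j} eq = cong suc (g-inj eq)
  y∷g∈p : ∀ i → (y ∷ g) i ∈ p
  y∷g∈p zero    = y∈p
  y∷g∈p (suc i) = g∈p i

join-injective : ∀ m n → Injective _≡_ _≡_ (join m n)
join-injective m n = Injection.injective (↔⇒↣ (↔-sym (+↔⊎ {m} {n})))

splitAt-injective : ∀ m n → Injective _≡_ _≡_ (splitAt m {n})
splitAt-injective m n = Injection.injective (↔⇒↣ (+↔⊎ {m} {n}))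

∣⊤++p∣ : ∀ k {n} (p : Subset n) → ∣ ⊤ {k} ++ p ∣ ≡ k + ∣ p ∣
∣⊤++p∣ zero    p = refl
∣⊤++p∣ (suc k) p = cong suc (∣⊤++p∣ k p)

↑ˡ∈⊤++p : ∀ {k n} (p : Subset n) (c : Fin k) → c ↑ˡ n ∈ ⊤ ++ p
↑ˡ∈⊤++p p zero    = here
↑ˡ∈⊤++p p (suc c) = there (↑ˡ∈⊤++p p c)

↑ʳ∈⊤++p : ∀ k {n} {p : Subset n} {a : Fin n} → a ∈ p → k ↑ʳ a ∈ ⊤ {k} ++ p
↑ʳ∈⊤++p zero    a∈p = a∈p
↑ʳ∈⊤++p (suc k) a∈p = there (↑ʳ∈⊤++p k a∈p)

injection-into-⊎⇒≤ : ∀ {m k n} {p : Subset n} (g : Fin m → Fin k ⊎ Fin n) →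
                     Injective _≡_ _≡_ g → (∀ i a → g i ≡ inj₂ a → a ∈ p) → m ≤ k + ∣ p ∣
injection-into-⊎⇒≤ {k = k} {n} {p} g g-inj g∈p =
  subst (_ ≤_) (∣⊤++p∣ k p) (injection-into⇒≤∣p∣ (join k n ∘ g) join∘g-inj join∘g∈⊤++p)
  where
  join∘g-inj : Injective _≡_ _≡_ (join k n ∘ g)
  join∘g-inj = g-inj ∘ join-injective k n
  join∘g∈⊤++p : ∀ i → join k n (g i) ∈ ⊤ ++ p
  join∘g∈⊤++p i with g i in eq
  ... | inj₁ c = ↑ˡ∈⊤++p p c
  ... | inj₂ a = ↑ʳ∈⊤++p k (g∈p i a eq)

adj-sym : ∀ {n} (G : Graph n) {u v} → GAdj G u v → GAdj G v u
adj-sym G {u} {v} = subst T (Graph.sym G u v)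

adj⇒≢ : ∀ {n} (G : Graph n) {u v} → GAdj G u v → u ≢ v
adj⇒≢ G {u} u~v refl = subst T (Graph.irrefl G u) u~v

star-free⇒¬l-neighbours : ∀ {n l} (G : Graph n) → Free (Star l) (GAdj G) →
                          (c : Fin n) (g : Fin l → Fin n) → Injective _≡_ _≡_ g →
                          ¬ (∀ i → GAdj G c (g i))
star-free⇒¬l-neighbours {n} {l} G star-free c g g-inj c~g =
  star-free (centre-g , centre-g-inj , centre-g-adj)
  where
  centre-g : Fin 1 ⊎ Fin l → Fin n
  centre-g (inj₁ _) = c
  centre-g (inj₂ i) = g i
  centre-g-inj : Injective _≡_ _≡_ centre-g
  centre-g-inj {inj₁ zero} {inj₁ zero} eq = refl
  centre-g-inj {inj₁ zero} {inj₂ i}    eq = ⊥-elim (adj⇒≢ G (c~g i) eq)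
  centre-g-inj {inj₂ i}    {inj₁ zero} eq = ⊥-elim (adj⇒≢ G (c~g i) (sym eq))
  centre-g-inj {inj₂ i}    {inj₂ j}    eq = cong inj₂ (g-inj eq)
  centre-g-adj : ∀ a b → Star l a b → GAdj G (centre-g a) (centre-g b)
  centre-g-adj (inj₁ _) (inj₂ i) _ = c~g i
  centre-g-adj (inj₂ i) (inj₁ _) _ = adj-sym G (c~g i)

data Covered {V : Set} {x m : ℕ} (ι : Fin x → V) (σ : Fin m → V) (u v : V) : Set where
  touches : (b : Bool) (a : Fin x) → (if b then v else u) ≡ ι a → Covered ι σ u v
  inside  : (c d : Fin m) → u ≡ σ c → v ≡ σ d → Covered ι σ u v

-- A matched vertex is named by the ι-vertex covering its edge together with its side, or
-- by its own σ-index; distinct matched vertices get distinct names.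
matching-bound : ∀ {V : Set} {Adj : V → V → Set} {x m k} (ι : Fin x → V) (σ : Fin m → V) →
                 (∀ {u v} → Adj u v → Covered ι σ u v) →
                 Contains (Matching k) Adj → k * 2 ≤ x * 2 + m
matching-bound {x = x} {m} {k} ι σ cover (f , f-inj , f-adj) =
  ↣⇒≤ (↔⇒↣ (↔-sym codomain) ↣-∘ (mk↣ code-injective ↣-∘ ↔⇒↣ ×Bool))
  where
  ×Bool : ∀ {r} → Fin (r * 2) ↔ (Fin r × Bool)
  ×Bool = (↔-id _ ×-↔ 2↔Bool) ↔-∘ *↔×
  codomain : Fin (x * 2 + m) ↔ ((Fin x × Bool) ⊎ Fin m)
  codomain = (×Bool ⊎-↔ ↔-id _) ↔-∘ +↔⊎

  edge : ∀ i → Covered ι σ (f (i , false)) (f (i , true))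
  edge i = cover (f-adj (i , false) (i , true) (refl , λ ()))

  end : ∀ i b → (if b then f (i , true) else f (i , false)) ≡ f (i , b)
  end i false = refl
  end i true  = refl

  inside-end : ∀ {i c d} → f (i , false) ≡ σ c → f (i , true) ≡ σ d →
               ∀ b → f (i , b) ≡ σ (if b then d else c)
  inside-end eqc eqd false = eqc
  inside-end eqc eqd true  = eqd

  code : ∀ {u v} → Covered ι σ u v → Bool → (Fin x × Bool) ⊎ Fin m
  code (touches _ a _)  b = inj₁ (a , b)
  code (inside c d _ _) b = inj₂ (if b then d else c)

  code-determines : ∀ i i' b b' (e : Covered ι σ (f (i , false)) (f (i , true)))
                    (e' : Covered ι σ (f (i' , false)) (f (i' , true))) →
                    code e b ≡ code e' b' → (i , b) ≡ (i' , b')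
  code-determines i i' b b' (touches w _ eq) (touches w' _ eq') refl =
    cong (_, b) (cong proj₁ (f-inj (trans (sym (end i w))
                                         (trans eq (trans (sym eq') (end i' w'))))))
  code-determines i i' b b' (touches _ _ _) (inside _ _ _ _) ()
  code-determines i i' b b' (inside _ _ _ _) (touches _ _ _) ()
  code-determines i i' b b' (inside _ _ eqc eqd) (inside _ _ eqc' eqd') eq =
    f-inj (trans (inside-end eqc eqd b)
                 (trans (cong σ (inj₂-injective eq)) (sym (inside-end eqc' eqd' b'))))

  code-injective : Injective _≡_ _≡_ (λ { (i , b) → code (edge i) b })
  code-injective {i , b} {i' , b'} = code-determines i i' b b' (edge i) (edge i')

n∸1<n : ∀ {n} → 0 < n → n ∸ 1 < n
n∸1<n {suc n} _ = n<1+n n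

x*2+sSize≡ : ∀ {x s} → x ≤ s → x * 2 + sSize s x ≡ suc (s * 2)
x*2+sSize≡ {x} {s} x≤s = begin
  x * 2 + (2 * (s ∸ x) + 1)  ≡⟨ double-sum x (s ∸ x) ⟩
  suc ((x + (s ∸ x)) * 2)    ≡⟨ cong (λ r → suc (r * 2)) (m+[n∸m]≡n x≤s) ⟩
  suc (s * 2)                ∎
  where
  open ≡-Reasoning
  double-sum : ∀ a d → a * 2 + (2 * d + 1) ≡ suc ((a + d) * 2)
  double-sum = solve-∀

LSub-≡ : ∀ {x l} {A B : LSub x l} → proj₁ A ≡ proj₁ B → A ≡ B
LSub-≡ {A = F , e} {.F , e'} refl = cong (F ,_) (≡-irrelevant e e')

module Construction (j : Bool) (l t s x n : ℕ) (X : Graph x) (S : Graph (sSize s x))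
                    (F0 : Subset x) where

  V : Set
  V = Vtx l t s x n

  _~_ : V → V → Set
  _~_ = GAdjC j l t s x n X S F0

  inX : Fin x → V
  inX = inj₁

  inV : LSub x l → Fin (t ∸ 1) → V
  inV F k = inj₂ (inj₁ (F , k))

  inS : Fin (sSize s x) → V
  inS c = inj₂ (inj₂ (inj₁ c))

  ~-sym : ∀ {u v} → u ~ v → v ~ u
  ~-sym {inj₁ _} {inj₁ _} = adj-sym X
  ~-sym {inj₁ _} {inj₂ (inj₁ _)} u~v = u~v
  ~-sym {inj₁ _} {inj₂ (inj₂ (inj₁ _))} u~v = u~v
  ~-sym {inj₁ _} {inj₂ (inj₂ (inj₂ _))} u~v = u~v
  ~-sym {inj₂ (inj₁ _)} {inj₁ _} u~v = u~v
  ~-sym {inj₂ (inj₂ (inj₁ _))} {inj₁ _} u~v = u~v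
  ~-sym {inj₂ (inj₂ (inj₂ _))} {inj₁ _} u~v = u~v
  ~-sym {inj₂ (inj₂ (inj₁ _))} {inj₂ (inj₂ (inj₁ _))} = adj-sym S

  edge-cover : ∀ {u v} → u ~ v → Covered inX inS u v
  edge-cover {inj₁ a} _ = touches false a refl
  edge-cover {inj₂ _} {inj₁ a} _ = touches true a refl
  edge-cover {inj₂ (inj₂ (inj₁ c))} {inj₂ (inj₂ (inj₁ d))} _ = inside c d refl refl

  matching-free : x ≤ s → Free (Matching (suc s)) _~_
  matching-free x≤s M = <-irrefl refl (≤-trans (matching-bound inX inS edge-cover M)
                                                (≤-reflexive (x*2+sSize≡ x≤s)))

  data InS∪F₀ (w : V) : Set where
    in-S  : (c : Fin (sSize s x)) → w ≡ inS c → InS∪F₀ w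
    in-F₀ : (a : Fin x) → T j → a ∈ F0 → w ≡ inX a → InS∪F₀ w

  S-neighbour : ∀ {c w} → inS c ~ w → InS∪F₀ w
  S-neighbour {w = inj₁ a} (jT , a∈F0) = in-F₀ a jT a∈F0 refl
  S-neighbour {w = inj₂ (inj₂ (inj₁ d))} _ = in-S d refl

  region : ∀ {w} → InS∪F₀ w → Fin (sSize s x) ⊎ Fin x
  region (in-S c _)      = inj₁ c
  region (in-F₀ a _ _ _) = inj₂ a

  region-determines : ∀ {w w'} (r : InS∪F₀ w) (r' : InS∪F₀ w') →
                      region r ≡ region r' → w ≡ w'
  region-determines (in-S _ eq) (in-S _ eq') refl = trans eq (sym eq')
  region-determines (in-F₀ _ _ _ eq) (in-F₀ _ _ _ eq') refl = trans eq (sym eq')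

  S∪F₀-bound : ∀ {m} (h : Fin m → V) → Injective _≡_ _≡_ h → (∀ i → InS∪F₀ (h i)) →
               m ≤ sSize s x + ∣ F0 ∣
  S∪F₀-bound h h-inj h∈ =
    injection-into-⊎⇒≤ (region ∘ h∈) (λ eq → h-inj (region-determines (h∈ _) (h∈ _) eq))
                        right∈F0
    where
    right∈F0 : ∀ i a → region (h∈ i) ≡ inj₂ a → a ∈ F0
    right∈F0 i a eq with h∈ i
    right∈F0 i a refl | in-F₀ .a _ a∈F0 _ = a∈F0

  IsX : V → Set
  IsX w = Σ (Fin x) λ a → w ≡ inX a

  isX? : ∀ w → Dec (IsX w)
  isX? (inj₁ a) = yes (a , refl)
  isX? (inj₂ _) = no λ ()

  module _ (0<l : 0 < l) (l≤t : l ≤ t) (X-free : Free (Star l) (GAdj X))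
           (∣F0∣≡l∸1 : ∣ F0 ∣ ≡ l ∸ 1) where

    0<t : 0 < t
    0<t = ≤-trans 0<l l≤t

    F₀-too-small : ∀ {p} (g : Fin p → Fin x) → Injective _≡_ _≡_ g → l ≤ p →
                   ¬ (∀ i → g i ∈ F0)
    F₀-too-small {p} g g-inj l≤p g∈F0 = <⇒≱ (n∸1<n 0<l) (begin
      l      ≤⟨ l≤p ⟩
      p      ≤⟨ injection-into⇒≤∣p∣ g g-inj g∈F0 ⟩
      ∣ F0 ∣ ≡⟨ ∣F0∣≡l∸1 ⟩
      l ∸ 1  ∎)
      where open ≤-Reasoning

    common-neighbour : ∀ {p} (g : Fin p → Fin x) → Injective _≡_ _≡_ g → l ≤ p →
                       ∀ w → (∀ i → w ~ inX (g i)) →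
                       Σ (LSub x l × Fin (t ∸ 1)) λ (F , k) → w ≡ inV F k × (∀ i → g i ∈ proj₁ F)
    common-neighbour g g-inj l≤p (inj₁ c) c~g =
      ⊥-elim (star-free⇒¬l-neighbours X X-free c (λ i → g (inject≤ i l≤p))
               (λ eq → inject≤-injective l≤p l≤p _ _ (g-inj eq)) (λ i → c~g (inject≤ i l≤p)))
    common-neighbour g g-inj l≤p (inj₂ (inj₁ (F , k))) g∈F = (F , k) , refl , g∈F
    common-neighbour g g-inj l≤p (inj₂ (inj₂ (inj₁ _))) w~g =
      ⊥-elim (F₀-too-small g g-inj l≤p (proj₂ ∘ w~g))
    common-neighbour g g-inj l≤p (inj₂ (inj₂ (inj₂ _))) w~g =
      ⊥-elim (F₀-too-small g g-inj l≤p w~g)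

    side-not-in-X : ∀ {p q} → l ≤ p → l + t ≤ p + q → 0 < q →
                    (u : Fin p → V) → Injective _≡_ _≡_ u →
                    (h : Fin q → V) → Injective _≡_ _≡_ h →
                    (∀ k i → h k ~ u i) → ¬ (∀ i → IsX (u i))
    side-not-in-X {p} {q} l≤p l+t≤p+q 0<q u u-inj h h-inj h~u u∈X = <⇒≱ (n∸1<n 0<t) t≤t∸1
      where
      g : Fin p → Fin x
      g i = proj₁ (u∈X i)

      g-inj : Injective _≡_ _≡_ g
      g-inj {i} {i'} eq =
        u-inj (trans (proj₂ (u∈X i)) (trans (cong inX eq) (sym (proj₂ (u∈X i')))))

      nb : ∀ k → Σ (LSub x l × Fin (t ∸ 1)) λ (F , slot) →
                   h k ≡ inV F slot × (∀ i → g i ∈ proj₁ F)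
      nb k = common-neighbour g g-inj l≤p (h k)
               (λ i → subst (h k ~_) (proj₂ (u∈X i)) (h~u k i))

      F : Fin q → LSub x l
      F k = proj₁ (proj₁ (nb k))

      slot : Fin q → Fin (t ∸ 1)
      slot k = proj₂ (proj₁ (nb k))

      k₀ : Fin q
      k₀ = fromℕ< 0<q

      ∣F∣≤p : ∀ k → ∣ proj₁ (F k) ∣ ≤ p
      ∣F∣≤p k = ≤-trans (≤-reflexive (proj₂ (F k))) l≤p

      F-constant : ∀ k → F k ≡ F k₀
      F-constant k = LSub-≡ (⊆-antisym
        (injection-onto⇒⊆ g g-inj (∣F∣≤p k)  (proj₂ (proj₂ (nb k)))  (proj₂ (proj₂ (nb k₀))))
        (injection-onto⇒⊆ g g-inj (∣F∣≤p k₀) (proj₂ (proj₂ (nb k₀))) (proj₂ (proj₂ (nb k)))))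

      h≡ : ∀ k → h k ≡ inV (F k₀) (slot k)
      h≡ k = trans (proj₁ (proj₂ (nb k))) (cong (λ F′ → inV F′ (slot k)) (F-constant k))

      slot-inj : Injective _≡_ _≡_ slot
      slot-inj {k} {k'} eq =
        h-inj (trans (h≡ k) (trans (cong (inV (F k₀)) eq) (sym (h≡ k'))))

      p≤l : p ≤ l
      p≤l = subst (p ≤_) (proj₂ (F k₀)) (injection-into⇒≤∣p∣ g g-inj (proj₂ (proj₂ (nb k₀))))

      t≤t∸1 : t ≤ t ∸ 1
      t≤t∸1 = ≤-trans (+-cancelˡ-≤ l t q (≤-trans l+t≤p+q (+-monoˡ-≤ q p≤l)))
                      (injective⇒≤ slot-inj)

    Kbip-within-S∪F₀ : (f : Fin l ⊎ Fin t → V) → Injective _≡_ _≡_ f →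
                       (∀ p q → KBip l t p q → f p ~ f q) → ∀ p → InS∪F₀ (f p)
    Kbip-within-S∪F₀ f f-inj f-adj
      with all? (λ i → isX? (f (inj₁ i))) | all? (λ k → isX? (f (inj₂ k)))
    ... | yes A⊆X | _ =
      ⊥-elim (side-not-in-X ≤-refl ≤-refl 0<t
                (f ∘ inj₁) (inj₁-injective ∘ f-inj) (f ∘ inj₂) (inj₂-injective ∘ f-inj)
                (λ k i → f-adj (inj₂ k) (inj₁ i) tt) A⊆X)
    ... | no _ | yes B⊆X =
      ⊥-elim (side-not-in-X l≤t (≤-reflexive (+-comm l t)) 0<l
                (f ∘ inj₂) (inj₂-injective ∘ f-inj) (f ∘ inj₁) (inj₁-injective ∘ f-inj)
                (λ i k → f-adj (inj₁ i) (inj₂ k) tt) B⊆X)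
    ... | no A⊈X | no B⊈X
      with ¬∀⟶∃¬ l _ (λ i → isX? (f (inj₁ i))) A⊈X
         | ¬∀⟶∃¬ t _ (λ k → isX? (f (inj₂ k))) B⊈X
    ... | a , a∉X | b , b∉X = within (edge-cover (f-adj (inj₁ a) (inj₂ b) tt))
      where
      within : Covered inX inS (f (inj₁ a)) (f (inj₂ b)) → ∀ p → InS∪F₀ (f p)
      within (touches false a′ eq) _ = ⊥-elim (a∉X (a′ , eq))
      within (touches true  b′ eq) _ = ⊥-elim (b∉X (b′ , eq))
      within (inside _ _ _ eqd) (inj₁ i) =
        S-neighbour (~-sym {f (inj₁ i)} (subst (f (inj₁ i) ~_) eqd (f-adj (inj₁ i) (inj₂ b) tt)))
      within (inside _ _ eqc _) (inj₂ k) =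
        S-neighbour (subst (_~ f (inj₂ k)) eqc (f-adj (inj₁ a) (inj₂ k) tt))

    Kbip-free-if-S-small : sSize s x ≤ t → Free (KBip l t) _~_
    Kbip-free-if-S-small S≤t (f , f-inj , f-adj) = <-irrefl refl (begin-strict
      l + t                  ≤⟨ S∪F₀-bound (f ∘ splitAt l) (λ eq → splitAt-injective l t (f-inj eq))
                                           (Kbip-within-S∪F₀ f f-inj f-adj ∘ splitAt l) ⟩
      sSize s x + ∣ F0 ∣     ≡⟨ cong (sSize s x +_) ∣F0∣≡l∸1 ⟩
      sSize s x + (l ∸ 1)    ≤⟨ +-monoˡ-≤ (l ∸ 1) S≤t ⟩
      t + (l ∸ 1)            <⟨ +-monoʳ-< t (n∸1<n 0<l) ⟩
      t + l                  ≡⟨ +-comm t l ⟩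
      l + t                  ∎)
      where open ≤-Reasoning

    Kbip-free-if-S-detached : ¬ T j → Free (KBip l t) (GAdj S) → Free (KBip l t) _~_
    Kbip-free-if-S-detached ¬j S-free (f , f-inj , f-adj) = S-free (g , g-inj , g-adj)
      where
      in-S-only : ∀ p → Σ (Fin (sSize s x)) λ c → f p ≡ inS c
      in-S-only p with Kbip-within-S∪F₀ f f-inj f-adj p
      ... | in-S c eq      = c , eq
      ... | in-F₀ _ jT _ _ = ⊥-elim (¬j jT)

      g : Fin l ⊎ Fin t → Fin (sSize s x)
      g p = proj₁ (in-S-only p)

      g-inj : Injective _≡_ _≡_ g
      g-inj {p} {q} eq =
        f-inj (trans (proj₂ (in-S-only p)) (trans (cong inS eq) (sym (proj₂ (in-S-only q)))))

      g-adj : ∀ p q → KBip l t p q → GAdj S (g p) (g q)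
      g-adj p q pq = subst₂ _~_ (proj₂ (in-S-only p)) (proj₂ (in-S-only q)) (f-adj p q pq)

lemma2p5 : (l t s x n : ℕ) → 2 ≤ l → l ≤ t → l + 1 ≤ s → x ≤ s → l ≤ x →
    x + (t ∸ 1) * (x C l) + 2 * (s ∸ x) + 1 ≤ n →
    (X : Graph x) → Extremal (Star l) X →
    (S : Graph (sSize s x)) → Extremal (KBip l t) S →
    (F0 : Subset x) → ∣ F0 ∣ ≡ l ∸ 1 →
    (2 * (s ∸ x) + 1 ≤ t → KMFree l t s (G1 l t s x n X S F0)) ×
    (t + 1 ≤ 2 * (s ∸ x) + 1 → KMFree l t s (G2 l t s x n X S F0))
lemma2p5 l t s x n 2≤l l≤t _ x≤s _ _ X (X-free , _) S (S-free , _) F0 ∣F0∣≡l∸1 =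
  (λ S≤t → G₁.Kbip-free-if-S-small 0<l l≤t X-free ∣F0∣≡l∸1 S≤t ,
           G₁.matching-free x≤s) ,
  -- part (b) holds without its size hypothesis
  (λ _   → G₂.Kbip-free-if-S-detached 0<l l≤t X-free ∣F0∣≡l∸1 (λ ()) S-free ,
           G₂.matching-free x≤s)
  where
  0<l : 0 < l
  0<l = ≤-trans (s≤s z≤n) 2≤l
  module G₁ = Construction true  l t s x n X S F0
  module G₂ = Construction false l t s x n X S F0
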